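{- Fix an anti-diagonal term order on $\mathbb{C}[z_{i,j}:1\le i,j\le n]$. For every row-strict composition tableau $Y$ with entries in $[n]$, the exponent matrix $\Psi(\rho(\Delta_Y))$ of the initial monomial $\rho(\Delta_Y)$ of $\Delta_Y$ lies in $\mathcal{AD}_n$.
   Context: Let $[n]=\{1,\dots,n\}$, $M=(z_{i,j})$ the $n\times n$ matrix of indeterminates. For $I\subseteq[n]$ with $|I|=k$, $\Delta_I$ is the determinant of the submatrix of $M$ on rows $1,\dots,k$ and columns $I$ (in increasing order). An anti-diagonal term order is a monomial order on $\mathbb{C}[z_{i,j}]$ such that for every such minor the anti-diagonal monomial is its initial (leading) term; i.e. if $I=\{a_1>a_2>\dots>a_k\}$, the initial term of $\Delta_I$ is $\pm z_{1,a_1}z_{2,a_2}\cdots z_{k,a_k}$. $\rho(f)$ denotes the initial monomial of $f$. $\Psi$ sends a monomial $\prod_{i,j}z_{i,j}^{k_{i,j}}$ to the integer matrix $(k_{i,j})_{i,j=1}^n$. A composition is a finite sequence $\alpha=(\alpha_1,\dots,\alpha_l)$ of positive integers; its diagram has $\alpha_i$ left-justified cells in row $i$. A row-strict composition tableau (RSCT) of shape $\alpha$ with entries in $[n]$ is a filling $Y$ of the diagram with entries in $[n]$ such that: (1) entries strictly decrease along each row; (2) entries of the leftmost column weakly increase top to bottom; (3) letting $m=\max\alpha_i$ and extending $Y$ by zeros to an $l\times m$ array $\overline{Y}$, for all $1\le i<j\le l$, $2\le k\le m$: $\overline{Y}(j,k)>\overline{Y}(i,k)$ implies $\overline{Y}(j,k)\ge\overline{Y}(i,k-1)$.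 $\Delta_Y$ is the product over rows of $Y$ of $\Delta_J$, $J$ the set of entries in that row. $\mathcal{AD}_n$ is the set of integer matrices $\Lambda=(\Lambda_{i,j})_{i,j=1}^n$ such that: (1) all entries are nonnegative; (2) if $k$ is the largest index with $\Lambda_{1,k}\ne0$ then $\Lambda_{2,k}=0$; (3) for every $i\in[n-1]$ and $p\in[n]$, $\sum_{j=p}^{n}\Lambda_{i+1,j}\le\sum_{j=p+1}^{n}\Lambda_{i,j}$. -}

module Defs where

open import Data.Nat as ℕ using (ℕ; zero; suc; _⊔_)
import Data.Nat.Properties as ℕP
open import Data.Integer as ℤ using (ℤ; +_; -_)
open import Data.Fin as Fin using (Fin; toℕ)
open import Data.Vec as Vec using (Vec; lookup; tabulate; replicate; zipWith)
open import Data.Vec.Properties using (≡-dec)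
open import Data.List as List using (List; []; _∷_; map; concatMap; length; drop; reverse; foldr)
open import Data.List.Relation.Unary.Linked using (Linked)
open import Data.Product using (_×_; _,_; proj₁; proj₂)
open import Data.Bool using (if_then_else_)
open import Relation.Nullary using (¬_; does)
open import Relation.Binary.PropositionalEquality using (_≡_; _≢_)
open import Relation.Binary.Structures using (IsStrictTotalOrder)
open import Level using (0ℓ)
open import Data.Nat.ListAction using () renaming (sum to sumℕ)
open import Data.List.Relation.Unary.All using (All)
open import Data.Sum using (_⊎_)
open import Data.Empty using (⊥)
open import Data.Unit using (⊤)

-- Monomials in the variables z_{i,j} (0-indexed: i,j : Fin n),
-- represented by their exponent matrices (so Ψ is the identity).

Mon : ℕ → Set
Mon n = Vec (Vec ℕ n) n

ent : ∀ {n} → Mon n → Fin n → Fin n → ℕ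
ent Λ i j = lookup (lookup Λ i) j

𝟙 : ∀ {n} → Mon n
𝟙 = replicate _ (replicate _ 0)

_⊗_ : ∀ {n} → Mon n → Mon n → Mon n
a ⊗ b = zipWith (zipWith ℕ._+_) a b

-- the variable z_{r,c} (r given as a natural number; r < n in all uses)
unitMon : ∀ {n} → ℕ → Fin n → Mon n
unitMon r c = tabulate λ i → tabulate λ j →
  if does (toℕ i ℕP.≟ r) then (if does (j Fin.≟ c) then 1 else 0) else 0

-- Polynomials with integer coefficients: finite formal sums of terms.
-- (All polynomials occurring here, the minors, have integer coefficients.)

Poly : ℕ → Set
Poly n = List (ℤ × Mon n)

polyOne : ∀ {n} → Poly n
polyOne = (+ 1 , 𝟙) ∷ []

_*P_ : ∀ {n} → Poly n → Poly n → Poly n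
f *P g = concatMap (λ t → map (λ s → (proj₁ t ℤ.* proj₁ s , proj₂ t ⊗ proj₂ s)) g) f

scaleP : ∀ {n} → ℤ → Poly n → Poly n
scaleP a f = map (λ t → (a ℤ.* proj₁ t , proj₂ t)) f

sumP : ∀ {n} → List (Poly n) → Poly n
sumP = foldr List._++_ []

productP : ∀ {n} → List (Poly n) → Poly n
productP = foldr _*P_ polyOne

-- variable z_{r,c} as a polynomial; zero polynomial if r ≥ n (never used)
varP : ∀ {n} → ℕ → Fin n → Poly n
varP {n} r c = if does (r ℕP.<? n) then (+ 1 , unitMon r c) ∷ [] else []

coeff : ∀ {n} → Poly n → Mon n → ℤ
coeff f m = foldr ℤ._+_ (+ 0)
  (map (λ t → if does (≡-dec (≡-dec ℕP._≟_) (proj₂ t) m) then proj₁ t else + 0) f)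

picks : ∀ {A : Set} → List A → List (ℕ × A × List A)
picks [] = []
picks (x ∷ xs) = (0 , x , xs) ∷
  map (λ p → (suc (proj₁ p) , proj₁ (proj₂ p) , x ∷ proj₂ (proj₂ p))) (picks xs)

sign : ℕ → ℤ
sign zero = + 1
sign (suc k) = - sign k

-- determinant of the submatrix on rows r, r+1, ..., r+k-1 and columns cs
-- (in the given order), k = fuel = length cs
detAux : ∀ {n} → ℕ → ℕ → List (Fin n) → Poly n
detAux zero r cs = polyOne
detAux (suc k) r cs = sumP (map (λ p →
  scaleP (sign (proj₁ p)) (varP r (proj₁ (proj₂ p)) *P detAux k (suc r) (proj₂ (proj₂ p))))
  (picks cs))

-- Δ_I for I given as a strictly increasing list of columns:
-- rows 1..|I| (0-indexed 0..|I|-1), columns I in increasing order.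
Δ : ∀ {n} → List (Fin n) → Poly n
Δ cs = detAux (length cs) 0 cs

-- a subset I ⊆ [n] as its strictly increasing list of elements
IsIncreasing : ∀ {n} → List (Fin n) → Set
IsIncreasing = Linked Fin._<_

-- anti-diagonal monomial z_{1,a_1} ... z_{k,a_k} for I = {a_1 > ... > a_k}
antiDiagAux : ∀ {n} → ℕ → List (Fin n) → Mon n
antiDiagAux r [] = 𝟙
antiDiagAux r (a ∷ as) = unitMon r a ⊗ antiDiagAux (suc r) as

antiDiag : ∀ {n} → List (Fin n) → Mon n
antiDiag cs = antiDiagAux 0 (reverse cs)

record MonomialOrder (n : ℕ) : Set₁ where
  field
    _≺_        : Mon n → Mon n → Set
    isSTO      : IsStrictTotalOrder _≡_ _≺_
    mult       : ∀ a b c → a ≺ b → (a ⊗ c) ≺ (b ⊗ c)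
    one-least  : ∀ a → a ≢ 𝟙 → 𝟙 ≺ a

IsInitial : ∀ {n} → MonomialOrder n → Poly n → Mon n → Set
IsInitial O f m =
  (coeff f m ≢ + 0) × (∀ m′ → coeff f m′ ≢ + 0 → (m′ ≡ m) ⊎ (MonomialOrder._≺_ O m′ m))

IsAntiDiagonal : ∀ {n} → MonomialOrder n → Set
IsAntiDiagonal {n} O = ∀ (I : List (Fin n)) → IsIncreasing I → IsInitial O (Δ I) (antiDiag I)

-- A tableau is its list of rows (top to bottom), each row a list of
-- entries (left to right). Entry e : Fin n stands for the number toℕ e + 1.

Tableau : ℕ → Set
Tableau n = List (List (Fin n))

NonEmpty : ∀ {A : Set} → List A → Set
NonEmpty [] = ⊥
NonEmpty (_ ∷ _) = ⊤

heads : ∀ {n} → Tableau n → List (Fin n)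
heads [] = []
heads ([] ∷ rs) = heads rs
heads ((x ∷ _) ∷ rs) = x ∷ heads rs

-- extended tableau Ȳ(i,k) (0-indexed), entries as numbers in [n], 0 outside the diagram
rowVal : ∀ {n} → List (Fin n) → ℕ → ℕ
rowVal [] k = 0
rowVal (x ∷ xs) zero = suc (toℕ x)
rowVal (x ∷ xs) (suc k) = rowVal xs k

Ybar : ∀ {n} → Tableau n → ℕ → ℕ → ℕ
Ybar [] i k = 0
Ybar (r ∷ rs) zero k = rowVal r k
Ybar (r ∷ rs) (suc i) k = Ybar rs i k

maxLen : ∀ {n} → Tableau n → ℕ
maxLen Y = foldr _⊔_ 0 (map length Y)

record IsRSCT {n : ℕ} (Y : Tableau n) : Set where
  field
    rowsNonEmpty : All NonEmpty Y
    rowStrict    : All (Linked Fin._>_) Y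
    firstCol     : Linked Fin._≤_ (heads Y)
    -- (3) triple condition (0-indexed rows i < j < l, columns 1 ≤ k < m)
    triple       : ∀ i j k → i ℕ.< j → j ℕ.< length Y → 1 ℕ.≤ k → k ℕ.< maxLen Y →
                   Ybar Y i k ℕ.< Ybar Y j k → Ybar Y i (k ℕ.∸ 1) ℕ.≤ Ybar Y j k

-- Δ_Y: product over rows of Δ_J, J = set of entries of the row
-- (a row is strictly decreasing, so its reverse lists J increasingly)
ΔY : ∀ {n} → Tableau n → Poly n
ΔY Y = productP (map (λ r → Δ (reverse r)) Y)

tailSum : ∀ {n} → Vec ℕ n → ℕ → ℕ
tailSum row p = sumℕ (drop p (Vec.toList row))

record InAD {n : ℕ} (Λ : Mon n) : Set where
  field
    -- (1) nonnegativity is automatic for ℕ entries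
    -- (2) if k is the largest index with Λ_{1,k} ≠ 0 then Λ_{2,k} = 0
    cond2 : ∀ (r₀ r₁ k : Fin n) → toℕ r₀ ≡ 0 → toℕ r₁ ≡ 1 →
            ent Λ r₀ k ≢ 0 → (∀ k′ → k Fin.< k′ → ent Λ r₀ k′ ≡ 0) →
            ent Λ r₁ k ≡ 0
    cond3 : ∀ (i i′ : Fin n) → toℕ i′ ≡ suc (toℕ i) → ∀ (p : ℕ) → p ℕ.< n →
            tailSum (lookup Λ i′) p ℕ.≤ tailSum (lookup Λ i) (suc p)

module Submission where

-- (A) Initial monomials are multiplicative for every monomial order:
--     ρ(f·g) = ρ(f)·ρ(g).  Hence ρ(Δ_Y) is the product
--     of the anti-diagonal monomials of the rows of Y (module TermOrder).
-- (B) The anti-diagonal monomial of a strictly decreasing row a₀ > a₁ > ⋯ has as its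
--     k-th row the unit vector at a_k (module AntiDiagonalRows).  Such a monomial
--     satisfies a strengthening AD⁺ of the defining conditions of AD_n; unlike AD_n,
--     the class AD⁺ contains 1 and is closed under products (module StrongAD, built on
--     the tail sums of unit rows in module UnitRows).
--
-- Only condition (1) of an RSCT, strictness of the rows, is used.

open import Defs
open import Data.Nat using (ℕ)
open import Data.Product using (∃; _×_)

open import Data.Product using (_,_; proj₁; proj₂)
open import Data.Sum using (_⊎_; inj₁; inj₂)
open import Data.Empty using (⊥-elim)
open import Data.Maybe using (Maybe; just; nothing)
open import Data.Bool using (if_then_else_)
open import Data.Fin as F using (Fin; toℕ)
open import Data.Vec as V using (Vec; lookup; tabulate; replicate; zipWith)
import Data.Vec.Properties as VP
open import Data.List as L using (List; []; _∷_; map; foldr; reverse; drop; head)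
import Data.List.Properties as LP
open import Data.List.Relation.Unary.All as All using (All; []; _∷_)
import Data.List.Relation.Unary.All.Properties as AllP
open import Data.List.Relation.Unary.Linked as Linked using (Linked; []; [-]; _∷_)
open import Relation.Nullary using (Dec; yes; no; does)
open import Relation.Nullary.Decidable using (dec-true; dec-false)
open import Relation.Binary.PropositionalEquality
open import Relation.Binary.Structures using (IsStrictTotalOrder)
open import Relation.Binary.Definitions using (tri<; tri≈; tri>)

module Monomials {n : ℕ} where
  import Data.Nat.Properties as ℕP

  infix 4 _≟M_
  _≟M_ : (a b : Mon n) → Dec (a ≡ b)
  _≟M_ = VP.≡-dec (VP.≡-dec ℕP._≟_)

  ⊗-comm : (a b : Mon n) → a ⊗ b ≡ b ⊗ a
  ⊗-comm = VP.zipWith-comm (VP.zipWith-comm ℕP.+-comm)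

  zipWith-cancelˡ : ∀ {A : Set} {m} {f : A → A → A} → (∀ a b c → f a b ≡ f a c → b ≡ c) →
                    (xs ys zs : Vec A m) → zipWith f xs ys ≡ zipWith f xs zs → ys ≡ zs
  zipWith-cancelˡ cancel V.[] V.[] V.[] _ = refl
  zipWith-cancelˡ cancel (x V.∷ xs) (y V.∷ ys) (z V.∷ zs) eq =
    cong₂ V._∷_ (cancel x y z (proj₁ (VP.∷-injective eq)))
                (zipWith-cancelˡ cancel xs ys zs (proj₂ (VP.∷-injective eq)))

  ⊗-cancelˡ : (a b c : Mon n) → a ⊗ b ≡ a ⊗ c → b ≡ c
  ⊗-cancelˡ = zipWith-cancelˡ (zipWith-cancelˡ ℕP.+-cancelˡ-≡)

module Coefficients {n : ℕ} where
  open import Data.Integer using (ℤ; +_; _+_; _*_)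
  import Data.Integer.Properties as ℤP
  open import Data.Integer.Solver using (module +-*-Solver)
  open Monomials {n}
  open ≡-Reasoning

  ⟪_∣_⟫ : Poly n → (Mon n → ℤ) → ℤ
  ⟪ [] ∣ H ⟫ = + 0
  ⟪ (c , x) ∷ f ∣ H ⟫ = c * H x + ⟪ f ∣ H ⟫

  -- The coefficient of the quotient m / x in g (zero when x does not divide m).
  quotCoeff : Poly n → Mon n → Mon n → ℤ
  quotCoeff [] x m = + 0
  quotCoeff ((c , y) ∷ g) x m = (if does (x ⊗ y ≟M m) then c else + 0) + quotCoeff g x m

  erase : (Mon n → ℤ) → Mon n → Mon n → ℤ
  erase H a x = if does (x ≟M a) then + 0 else H x

  erase-at : ∀ H a → erase H a a ≡ + 0
  erase-at H a = cong (λ b → if b then + 0 else H a) (dec-true (a ≟M a) refl)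

  coeff-cons-at : ∀ c x (f : Poly n) → coeff ((c , x) ∷ f) x ≡ c + coeff f x
  coeff-cons-at c x f = cong (λ b → (if b then c else + 0) + coeff f x) (dec-true (x ≟M x) refl)

  coeff-cons-off : ∀ c {x a} (f : Poly n) → x ≢ a → coeff ((c , x) ∷ f) a ≡ coeff f a
  coeff-cons-off c {x} {a} f x≢a =
    trans (cong (λ b → (if b then c else + 0) + coeff f a) (dec-false (x ≟M a) x≢a))
          (ℤP.+-identityˡ (coeff f a))

  coeff-++ : ∀ (f g : Poly n) m → coeff (f L.++ g) m ≡ coeff f m + coeff g m
  coeff-++ [] g m = sym (ℤP.+-identityˡ (coeff g m))
  coeff-++ ((c , x) ∷ f) g m =
    trans (cong (λ z → (if does (x ≟M m) then c else + 0) + z) (coeff-++ f g m))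
          (sym (ℤP.+-assoc (if does (x ≟M m) then c else + 0) (coeff f m) (coeff g m)))

  coeff-term-*P : ∀ c x (g : Poly n) m →
                  coeff (map (λ s → (c * proj₁ s , x ⊗ proj₂ s)) g) m ≡ c * quotCoeff g x m
  coeff-term-*P c x [] m = sym (ℤP.*-zeroʳ c)
  coeff-term-*P c x ((d , y) ∷ g) m =
    trans (cong (λ z → (if does (x ⊗ y ≟M m) then c * d else + 0) + z) (coeff-term-*P c x g m))
          (trans (cong (_+ c * quotCoeff g x m) (scaled (x ⊗ y ≟M m)))
                 (sym (ℤP.*-distribˡ-+ c _ (quotCoeff g x m))))
    where
    scaled : ∀ {P : Set} (b : Dec P) → (if does b then c * d else + 0) ≡ c * (if does b then d else + 0)
    scaled (yes _) = refl
    scaled (no _) = sym (ℤP.*-zeroʳ c)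

  coeff-*P : ∀ (f g : Poly n) m → coeff (f *P g) m ≡ ⟪ f ∣ (λ x → quotCoeff g x m) ⟫
  coeff-*P [] g m = refl
  coeff-*P ((c , x) ∷ f) g m =
    trans (coeff-++ (map (λ s → (c * proj₁ s , x ⊗ proj₂ s)) g) (f *P g) m)
          (cong₂ _+_ (coeff-term-*P c x g m) (coeff-*P f g m))

  -- When x divides m, quotCoeff is the coefficient of the (unique, by cancellation) quotient.
  quotCoeff-exact : ∀ (g : Poly n) x y m → x ⊗ y ≡ m → quotCoeff g x m ≡ coeff g y
  quotCoeff-exact [] x y m _ = refl
  quotCoeff-exact ((c , z) ∷ g) x y m xy≡m = cong₂ _+_ same-test (quotCoeff-exact g x y m xy≡m)
    where
    same-test : (if does (x ⊗ z ≟M m) then c else + 0) ≡ (if does (z ≟M y) then c else + 0)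
    same-test with x ⊗ z ≟M m | z ≟M y
    ... | yes _  | yes _  = refl
    ... | no _   | no _   = refl
    ... | yes xz≡m | no z≢y = ⊥-elim (z≢y (⊗-cancelˡ x z y (trans xz≡m (sym xy≡m))))
    ... | no xz≢m | yes z≡y = ⊥-elim (xz≢m (trans (cong (x ⊗_) z≡y) xy≡m))

  quotCoeff-divides : ∀ (g : Poly n) x m → quotCoeff g x m ≢ + 0 → ∃ λ y → x ⊗ y ≡ m
  quotCoeff-divides [] x m nz = ⊥-elim (nz refl)
  quotCoeff-divides ((c , y) ∷ g) x m nz with x ⊗ y ≟M m
  ... | yes xy≡m = y , xy≡m
  ... | no _ = quotCoeff-divides g x m (λ z → nz (trans (ℤP.+-identityˡ _) z))

  quotCoeff-vanish : ∀ (g : Poly n) x m → (∀ y → coeff g y ≢ + 0 → x ⊗ y ≢ m) →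
                     quotCoeff g x m ≡ + 0
  quotCoeff-vanish g x m avoid with quotCoeff g x m ℤP.≟ + 0
  ... | yes q≡0 = q≡0
  ... | no q≢0 with quotCoeff-divides g x m q≢0
  ...   | y , xy≡m = ⊥-elim (avoid y (λ c≡0 → q≢0 (trans (quotCoeff-exact g x y m xy≡m) c≡0)) xy≡m)

  term-split : ∀ (c : ℤ) (H : Mon n → ℤ) x a →
    c * H x ≡ c * (if does (x ≟M a) then + 0 else H x) + (if does (x ≟M a) then c else + 0) * H a
  term-split c H x a with x ≟M a
  ... | yes refl = trans (sym (ℤP.+-identityˡ (c * H x))) (cong (_+ c * H x) (sym (ℤP.*-zeroʳ c)))
  ... | no _ = trans (sym (ℤP.+-identityʳ (c * H x))) (cong (λ z → c * H x + z) (sym (ℤP.*-zeroˡ (H a))))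

  regroup : ∀ p q h r s → (p + q * h) + (r + s * h) ≡ (p + r) + (q + s) * h
  regroup = solve 5 (λ p q h r s → (p :+ q :* h) :+ (r :+ s :* h) := (p :+ r) :+ (q :+ s) :* h) refl
    where open +-*-Solver

  pair-split : ∀ (f : Poly n) H a → ⟪ f ∣ H ⟫ ≡ ⟪ f ∣ erase H a ⟫ + coeff f a * H a
  pair-split [] H a = sym (ℤP.*-zeroˡ (H a))
  pair-split ((c , x) ∷ f) H a =
    trans (cong₂ _+_ (term-split c H x a) (pair-split f H a))
          (regroup (c * erase H a x) (if does (x ≟M a) then c else + 0) (H a) ⟪ f ∣ erase H a ⟫ (coeff f a))

  product-vanishes : ∀ (u v : ℤ) → (u ≢ + 0 → v ≡ + 0) → u * v ≡ + 0
  product-vanishes u v h with u ℤP.≟ + 0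
  ... | yes refl = ℤP.*-zeroˡ v
  ... | no u≢0 = trans (cong (u *_) (h u≢0)) (ℤP.*-zeroʳ u)

  pair-vanish : ∀ (f : Poly n) H → (∀ x → coeff f x ≢ + 0 → H x ≡ + 0) → ⟪ f ∣ H ⟫ ≡ + 0
  pair-vanish [] H _ = refl
  pair-vanish ((c , x) ∷ f) H vanish = begin
    ⟪ (c , x) ∷ f ∣ H ⟫
      ≡⟨ pair-split ((c , x) ∷ f) H x ⟩
    (c * erase H x x + ⟪ f ∣ erase H x ⟫) + coeff ((c , x) ∷ f) x * H x
      ≡⟨ cong₂ _+_ (cong₂ _+_ (trans (cong (c *_) (erase-at H x)) (ℤP.*-zeroʳ c))
                              (pair-vanish f (erase H x) vanish-rest))
                   (product-vanishes _ (H x) (vanish x)) ⟩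
    + 0 ∎
    where
    vanish-rest : ∀ y → coeff f y ≢ + 0 → erase H x y ≡ + 0
    vanish-rest y nz with y ≟M x
    ... | yes refl = refl
    ... | no y≢x = vanish y (λ z → nz (trans (sym (coeff-cons-off c f (λ e → y≢x (sym e)))) z))

  pair-concentrated : ∀ (f : Poly n) H a → (∀ x → coeff f x ≢ + 0 → x ≢ a → H x ≡ + 0) →
                      ⟪ f ∣ H ⟫ ≡ coeff f a * H a
  pair-concentrated f H a away = begin
    ⟪ f ∣ H ⟫                                 ≡⟨ pair-split f H a ⟩
    ⟪ f ∣ erase H a ⟫ + coeff f a * H a      ≡⟨ cong (_+ coeff f a * H a) (pair-vanish f (erase H a) vanish) ⟩
    + 0 + coeff f a * H a                     ≡⟨ ℤP.+-identityˡ _ ⟩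
    coeff f a * H a ∎
    where
    vanish : ∀ x → coeff f x ≢ + 0 → erase H a x ≡ + 0
    vanish x nz with x ≟M a
    ... | yes refl = refl
    ... | no x≢a = away x nz x≢a

  coeff-*P-vanish : ∀ (f g : Poly n) m →
    (∀ x y → coeff f x ≢ + 0 → coeff g y ≢ + 0 → x ⊗ y ≢ m) → coeff (f *P g) m ≡ + 0
  coeff-*P-vanish f g m avoid =
    trans (coeff-*P f g m)
          (pair-vanish f _ (λ x nzx → quotCoeff-vanish g x m (λ y → avoid x y nzx)))

  coeff-*P-unique : ∀ (f g : Poly n) a b →
    (∀ x y → coeff f x ≢ + 0 → coeff g y ≢ + 0 → x ⊗ y ≡ a ⊗ b → x ≡ a) →
    coeff (f *P g) (a ⊗ b) ≡ coeff f a * coeff g b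
  coeff-*P-unique f g a b unique = begin
    coeff (f *P g) (a ⊗ b)                     ≡⟨ coeff-*P f g (a ⊗ b) ⟩
    ⟪ f ∣ (λ x → quotCoeff g x (a ⊗ b)) ⟫      ≡⟨ pair-concentrated f _ a away ⟩
    coeff f a * quotCoeff g a (a ⊗ b)          ≡⟨ cong (coeff f a *_) (quotCoeff-exact g a b (a ⊗ b) refl) ⟩
    coeff f a * coeff g b ∎
    where
    away : ∀ x → coeff f x ≢ + 0 → x ≢ a → quotCoeff g x (a ⊗ b) ≡ + 0
    away x nzx x≢a = quotCoeff-vanish g x (a ⊗ b) (λ y nzy xy≡ab → x≢a (unique x y nzx nzy xy≡ab))

module TermOrder {n : ℕ} (O : MonomialOrder n) where
  open import Data.Integer using (+_)
  import Data.Integer.Properties as ℤP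
  open MonomialOrder O
  open Monomials {n}
  open Coefficients {n}
  private module STO = IsStrictTotalOrder isSTO

  _≼_ : Mon n → Mon n → Set
  a ≼ b = (a ≡ b) ⊎ (a ≺ b)

  ⊗-monoʳ-≺ : ∀ a {y b} → y ≺ b → (a ⊗ y) ≺ (a ⊗ b)
  ⊗-monoʳ-≺ a {y} {b} y≺b = subst₂ _≺_ (⊗-comm y a) (⊗-comm b a) (mult y b a y≺b)

  ⊗-mono-≺-≼ : ∀ {x a y b} → x ≺ a → y ≼ b → (x ⊗ y) ≺ (a ⊗ b)
  ⊗-mono-≺-≼ {x} {a} {y} x≺a (inj₁ refl) = mult x a y x≺a
  ⊗-mono-≺-≼ {x} {a} {y} x≺a (inj₂ y≺b) = STO.trans (mult x a y x≺a) (⊗-monoʳ-≺ a y≺b)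

  ⊗-mono-≼ : ∀ {x a y b} → x ≼ a → y ≼ b → (x ⊗ y) ≼ (a ⊗ b)
  ⊗-mono-≼ (inj₂ x≺a) y≼b = inj₂ (⊗-mono-≺-≼ x≺a y≼b)
  ⊗-mono-≼ (inj₁ refl) (inj₁ refl) = inj₁ refl
  ⊗-mono-≼ {x} (inj₁ refl) (inj₂ y≺b) = inj₂ (⊗-monoʳ-≺ x y≺b)

  initial-*P : ∀ (f g : Poly n) a b → IsInitial O f a → IsInitial O g b →
               IsInitial O (f *P g) (a ⊗ b)
  initial-*P f g a b (fa≢0 , f≼a) (gb≢0 , g≼b) = ab≢0 , below-ab
    where
    -- a·b is reached from the supports only as a·b: a smaller x would give x·y ≺ a·b.
    only-a : ∀ x y → coeff f x ≢ + 0 → coeff g y ≢ + 0 → x ⊗ y ≡ a ⊗ b → x ≡ a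
    only-a x y nzx nzy xy≡ab with f≼a x nzx
    ... | inj₁ x≡a = x≡a
    ... | inj₂ x≺a = ⊥-elim (STO.irrefl xy≡ab (⊗-mono-≺-≼ x≺a (g≼b y nzy)))

    ab≢0 : coeff (f *P g) (a ⊗ b) ≢ + 0
    ab≢0 z with ℤP.i*j≡0⇒i≡0∨j≡0 (coeff f a) (trans (sym (coeff-*P-unique f g a b only-a)) z)
    ... | inj₁ fa≡0 = fa≢0 fa≡0
    ... | inj₂ gb≡0 = gb≢0 gb≡0

    below-ab : ∀ m → coeff (f *P g) m ≢ + 0 → m ≼ (a ⊗ b)
    below-ab m nz with STO.compare m (a ⊗ b)
    ... | tri< m≺ab _ _ = inj₂ m≺ab
    ... | tri≈ _ m≡ab _ = inj₁ m≡ab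
    ... | tri> _ _ ab≺m = ⊥-elim (nz (coeff-*P-vanish f g m unreachable))
      where
      unreachable : ∀ x y → coeff f x ≢ + 0 → coeff g y ≢ + 0 → x ⊗ y ≢ m
      unreachable x y nzx nzy refl with ⊗-mono-≼ (f≼a x nzx) (g≼b y nzy)
      ... | inj₁ xy≡ab = STO.irrefl (sym xy≡ab) ab≺m
      ... | inj₂ xy≺ab = STO.irrefl refl (STO.trans ab≺m xy≺ab)

  initial-polyOne : IsInitial O polyOne 𝟙
  initial-polyOne = one≢0 , below-one
    where
    one≢0 : coeff (polyOne {n}) 𝟙 ≢ + 0
    one≢0 z with trans (sym (coeff-cons-at (+ 1) (𝟙 {n}) [])) z
    ... | ()
    below-one : ∀ m → coeff (polyOne {n}) m ≢ + 0 → m ≼ 𝟙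
    below-one m nz with 𝟙 ≟M m
    ... | yes 𝟙≡m = inj₁ (sym 𝟙≡m)
    ... | no _ = ⊥-elim (nz refl)

  initial-productP : ∀ {A : Set} (F : A → Poly n) (G : A → Mon n) (xs : List A) →
                     All (λ r → IsInitial O (F r) (G r)) xs →
                     IsInitial O (productP (map F xs)) (foldr _⊗_ 𝟙 (map G xs))
  initial-productP F G [] [] = initial-polyOne
  initial-productP F G (x ∷ xs) (init ∷ inits) =
    initial-*P (F x) _ (G x) _ init (initial-productP F G xs inits)

module UnitRows where
  open import Data.Nat using (zero; suc; _+_; _≤_; _<_; z≤n; s≤s)
  import Data.Nat.Properties as ℕP
  open import Algebra.Properties.CommutativeSemigroup ℕP.+-commutativeSemigroup using (interchange)

  indicator : ∀ {m} → Maybe (Fin m) → Vec ℕ m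
  indicator nothing = replicate _ 0
  indicator (just c) = tabulate λ j → if does (j F.≟ c) then 1 else 0

  tabulate-const : ∀ {A : Set} m (x : A) → tabulate {n = m} (λ _ → x) ≡ replicate m x
  tabulate-const zero x = refl
  tabulate-const (suc m) x = cong (x V.∷_) (tabulate-const m x)

  lookup-indicator-at : ∀ {m} (c : Fin m) → lookup (indicator (just c)) c ≡ 1
  lookup-indicator-at c = trans (VP.lookup∘tabulate _ c)
                                (cong (λ b → if b then 1 else 0) (dec-true (c F.≟ c) refl))

  lookup-indicator-off : ∀ {m} {c j : Fin m} → j ≢ c → lookup (indicator (just c)) j ≡ 0
  lookup-indicator-off {c = c} {j} j≢c = trans (VP.lookup∘tabulate _ j)
                                              (cong (λ b → if b then 1 else 0) (dec-false (j F.≟ c) j≢c))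

  tailSum-zipWith : ∀ {m} (u v : Vec ℕ m) p → tailSum (zipWith _+_ u v) p ≡ tailSum u p + tailSum v p
  tailSum-zipWith V.[] V.[] zero = refl
  tailSum-zipWith V.[] V.[] (suc p) = refl
  tailSum-zipWith (x V.∷ u) (y V.∷ v) zero =
    trans (cong ((x + y) +_) (tailSum-zipWith u v zero)) (interchange x y _ _)
  tailSum-zipWith (x V.∷ u) (y V.∷ v) (suc p) = tailSum-zipWith u v p

  tailSum-nothing : ∀ {m} p → tailSum (indicator {m} nothing) p ≡ 0
  tailSum-nothing {zero} zero = refl
  tailSum-nothing {zero} (suc p) = refl
  tailSum-nothing {suc m} zero = tailSum-nothing {m} zero
  tailSum-nothing {suc m} (suc p) = tailSum-nothing {m} p

  tailSum-unit-rest : ∀ m p → tailSum (tabulate {n = m} (λ _ → 0)) p ≡ 0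
  tailSum-unit-rest m p = trans (cong (λ v → tailSum v p) (tabulate-const m 0)) (tailSum-nothing p)

  tailSum-unit-in : ∀ {m} (c : Fin m) p → p ≤ toℕ c → tailSum (indicator (just c)) p ≡ 1
  tailSum-unit-in {suc m} F.zero zero _ = cong suc (tailSum-unit-rest m zero)
  tailSum-unit-in (F.suc c) zero _ = tailSum-unit-in c zero z≤n
  tailSum-unit-in (F.suc c) (suc p) (s≤s p≤c) = tailSum-unit-in c p p≤c

  tailSum-unit-out : ∀ {m} (c : Fin m) p → toℕ c < p → tailSum (indicator (just c)) p ≡ 0
  tailSum-unit-out {suc m} F.zero (suc p) _ = tailSum-unit-rest m p
  tailSum-unit-out (F.suc c) (suc p) (s≤s c<p) = tailSum-unit-out c p c<p

  tailSum-unit-shift : ∀ {m} {y x : Fin m} → y F.< x → ∀ p →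
                       tailSum (indicator (just y)) p ≤ tailSum (indicator (just x)) (suc p)
  tailSum-unit-shift {y = y} {x} y<x p with p ℕP.≤? toℕ y
  ... | yes p≤y = ℕP.≤-reflexive (trans (tailSum-unit-in y p p≤y)
                                        (sym (tailSum-unit-in x (suc p) (ℕP.≤-<-trans p≤y y<x))))
  ... | no p≰y = ℕP.≤-trans (ℕP.≤-reflexive (tailSum-unit-out y p (ℕP.≰⇒> p≰y))) z≤n

module AntiDiagonalRows {n : ℕ} where
  open import Data.Nat using (zero; suc; _+_; _<_; s≤s)
  import Data.Nat.Properties as ℕP
  open UnitRows

  lookup-⊗ : ∀ (a b : Mon n) i → lookup (a ⊗ b) i ≡ zipWith _+_ (lookup a i) (lookup b i)
  lookup-⊗ a b i = VP.lookup-zipWith (zipWith _+_) i a b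

  row-unitMon-on : ∀ r c (i : Fin n) → toℕ i ≡ r → lookup (unitMon r c) i ≡ indicator (just c)
  row-unitMon-on r c i i≡r =
    trans (VP.lookup∘tabulate _ i)
          (cong (λ b → tabulate λ j → if b then (if does (j F.≟ c) then 1 else 0) else 0)
                (dec-true (toℕ i ℕP.≟ r) i≡r))

  row-unitMon-off : ∀ r c (i : Fin n) → toℕ i ≢ r → lookup (unitMon r c) i ≡ indicator nothing
  row-unitMon-off r c i i≢r =
    trans (VP.lookup∘tabulate _ i)
          (trans (cong (λ b → tabulate λ j → if b then (if does (j F.≟ c) then 1 else 0) else 0)
                       (dec-false (toℕ i ℕP.≟ r) i≢r))
                 (tabulate-const n 0))

  row-antiDiag-above : ∀ r xs (i : Fin n) → toℕ i < r → lookup (antiDiagAux r xs) i ≡ indicator nothing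
  row-antiDiag-above r [] i _ = VP.lookup-replicate i _
  row-antiDiag-above r (x ∷ xs) i i<r = begin
    lookup (unitMon r x ⊗ antiDiagAux (suc r) xs) i
      ≡⟨ lookup-⊗ (unitMon r x) _ i ⟩
    zipWith _+_ (lookup (unitMon r x) i) (lookup (antiDiagAux (suc r) xs) i)
      ≡⟨ cong₂ (zipWith _+_) (row-unitMon-off r x i (ℕP.<⇒≢ i<r))
                             (row-antiDiag-above (suc r) xs i (ℕP.m<n⇒m<1+n i<r)) ⟩
    zipWith _+_ (indicator nothing) (indicator nothing)
      ≡⟨ VP.zipWith-identityˡ ℕP.+-identityˡ _ ⟩
    indicator nothing ∎
    where open ≡-Reasoning

  row-antiDiag : ∀ r xs k (i : Fin n) → toℕ i ≡ r + k →
                 lookup (antiDiagAux r xs) i ≡ indicator (head (drop k xs))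
  row-antiDiag r [] zero i _ = VP.lookup-replicate i _
  row-antiDiag r [] (suc k) i _ = VP.lookup-replicate i _
  row-antiDiag r (x ∷ xs) zero i i≡r+0 =
    trans (lookup-⊗ (unitMon r x) _ i)
          (trans (cong₂ (zipWith _+_) (row-unitMon-on r x i i≡r)
                                      (row-antiDiag-above (suc r) xs i (s≤s (ℕP.≤-reflexive i≡r))))
                 (VP.zipWith-identityʳ ℕP.+-identityʳ _))
    where
    i≡r : toℕ i ≡ r
    i≡r = trans i≡r+0 (ℕP.+-identityʳ r)
  row-antiDiag r (x ∷ xs) (suc k) i i≡r+1+k =
    trans (lookup-⊗ (unitMon r x) _ i)
          (trans (cong₂ (zipWith _+_) (row-unitMon-off r x i i≢r)
                                      (row-antiDiag (suc r) xs k i (trans i≡r+1+k (ℕP.+-suc r k))))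
                 (VP.zipWith-identityˡ ℕP.+-identityˡ _))
    where
    i≢r : toℕ i ≢ r
    i≢r i≡r = ℕP.m≢1+m+n r (trans (sym i≡r) (trans i≡r+1+k (ℕP.+-suc r k)))

module StrongAD {n : ℕ} where
  open import Data.Nat using (zero; suc; _+_; _≤_; z≤n)
  import Data.Nat.Properties as ℕP
  open UnitRows
  open AntiDiagonalRows {n}

  -- Condition (2), strengthened: row 1 vanishes in every column beyond which row 0 vanishes
  -- (not only in the last nonzero column of row 0).
  RowOneBeyondRowZero : Mon n → Set
  RowOneBeyondRowZero Λ = ∀ (r₀ r₁ k : Fin n) → toℕ r₀ ≡ 0 → toℕ r₁ ≡ 1 →
                          (∀ k′ → k F.< k′ → ent Λ r₀ k′ ≡ 0) → ent Λ r₁ k ≡ 0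

  TailDominated : Mon n → Set
  TailDominated Λ = ∀ (i i′ : Fin n) → toℕ i′ ≡ suc (toℕ i) → ∀ p →
                    tailSum (lookup Λ i′) p ≤ tailSum (lookup Λ i) (suc p)

  AD⁺ : Mon n → Set
  AD⁺ Λ = RowOneBeyondRowZero Λ × TailDominated Λ

  AD⁺⇒InAD : ∀ {Λ} → AD⁺ Λ → InAD Λ
  AD⁺⇒InAD (rowOne , tails) = record
    { cond2 = λ r₀ r₁ k e₀ e₁ _ beyond → rowOne r₀ r₁ k e₀ e₁ beyond
    ; cond3 = λ i i′ e p _ → tails i i′ e p }

  ent-⊗ : ∀ (a b : Mon n) i j → ent (a ⊗ b) i j ≡ ent a i j + ent b i j
  ent-⊗ a b i j = trans (cong (λ v → lookup v j) (lookup-⊗ a b i))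
                        (VP.lookup-zipWith _+_ j (lookup a i) (lookup b i))

  lookup-𝟙 : ∀ i → lookup (𝟙 {n}) i ≡ indicator nothing
  lookup-𝟙 i = VP.lookup-replicate i _

  AD⁺-𝟙 : AD⁺ 𝟙
  AD⁺-𝟙 = (λ r₀ r₁ k _ _ _ → trans (cong (λ v → lookup v k) (lookup-𝟙 r₁)) (VP.lookup-replicate k 0))
        , (λ i i′ _ p → ℕP.≤-trans (ℕP.≤-reflexive (trans (cong (λ v → tailSum v p) (lookup-𝟙 i′))
                                                             (tailSum-nothing {n} p)))
                                   z≤n)

  AD⁺-⊗ : ∀ {a b} → AD⁺ a → AD⁺ b → AD⁺ (a ⊗ b)
  AD⁺-⊗ {a} {b} (rowOneᵃ , tailsᵃ) (rowOneᵇ , tailsᵇ) = rowOne , tails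
    where
    rowOne : RowOneBeyondRowZero (a ⊗ b)
    rowOne r₀ r₁ k e₀ e₁ beyond =
      trans (ent-⊗ a b r₁ k)
            (cong₂ _+_ (rowOneᵃ r₀ r₁ k e₀ e₁ (λ k′ k<k′ → ℕP.m+n≡0⇒m≡0 _ (split k′ k<k′)))
                       (rowOneᵇ r₀ r₁ k e₀ e₁ (λ k′ k<k′ → ℕP.m+n≡0⇒n≡0 (ent a r₀ k′) (split k′ k<k′))))
      where
      split : ∀ k′ → k F.< k′ → ent a r₀ k′ + ent b r₀ k′ ≡ 0
      split k′ k<k′ = trans (sym (ent-⊗ a b r₀ k′)) (beyond k′ k<k′)

    tailSum-⊗ : ∀ i p → tailSum (lookup (a ⊗ b) i) p ≡ tailSum (lookup a i) p + tailSum (lookup b i) p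
    tailSum-⊗ i p = trans (cong (λ v → tailSum v p) (lookup-⊗ a b i))
                          (tailSum-zipWith (lookup a i) (lookup b i) p)

    tails : TailDominated (a ⊗ b)
    tails i i′ e p = begin
      tailSum (lookup (a ⊗ b) i′) p                              ≡⟨ tailSum-⊗ i′ p ⟩
      tailSum (lookup a i′) p + tailSum (lookup b i′) p          ≤⟨ ℕP.+-mono-≤ (tailsᵃ i i′ e p) (tailsᵇ i i′ e p) ⟩
      tailSum (lookup a i) (suc p) + tailSum (lookup b i) (suc p) ≡⟨ tailSum-⊗ i (suc p) ⟨
      tailSum (lookup (a ⊗ b) i) (suc p) ∎
      where open ℕP.≤-Reasoning

  AD⁺-product : ∀ (ms : List (Mon n)) → All AD⁺ ms → AD⁺ (foldr _⊗_ 𝟙 ms)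
  AD⁺-product [] [] = AD⁺-𝟙
  AD⁺-product (m ∷ ms) (adm ∷ adms) = AD⁺-⊗ {m} adm (AD⁺-product ms adms)

  second-beyond-first : ∀ {xs : List (Fin n)} → Linked F._>_ xs → ∀ k →
    (∀ k′ → k F.< k′ → lookup (indicator (head xs)) k′ ≡ 0) → lookup (indicator (head (drop 1 xs))) k ≡ 0
  second-beyond-first [] k _ = VP.lookup-replicate k 0
  second-beyond-first [-] k _ = VP.lookup-replicate k 0
  second-beyond-first {x₀ ∷ x₁ ∷ _} (x₀>x₁ ∷ _) k beyond with k F.≟ x₁
  ... | yes refl = ⊥-elim (ℕP.1+n≢0 (trans (sym (lookup-indicator-at x₀)) (beyond x₀ x₀>x₁)))
  ... | no k≢x₁ = lookup-indicator-off k≢x₁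

  consecutive-dominated : ∀ {xs : List (Fin n)} → Linked F._>_ xs → ∀ k p →
    tailSum (indicator (head (drop (suc k) xs))) p ≤ tailSum (indicator (head (drop k xs))) (suc p)
  consecutive-dominated {[]} _ zero p = ℕP.≤-trans (ℕP.≤-reflexive (tailSum-nothing {n} p)) z≤n
  consecutive-dominated {[]} _ (suc k) p = ℕP.≤-trans (ℕP.≤-reflexive (tailSum-nothing {n} p)) z≤n
  consecutive-dominated {_ ∷ []} _ zero p = ℕP.≤-trans (ℕP.≤-reflexive (tailSum-nothing {n} p)) z≤n
  consecutive-dominated {_ ∷ _ ∷ _} (x₀>x₁ ∷ _) zero p = tailSum-unit-shift x₀>x₁ p
  consecutive-dominated {_ ∷ _} dec (suc k) p = consecutive-dominated (Linked.tail dec) k p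

  AD⁺-antiDiag : ∀ {xs : List (Fin n)} → Linked F._>_ xs → AD⁺ (antiDiagAux 0 xs)
  AD⁺-antiDiag {xs} dec = rowOne , tails
    where
    row : ∀ i → lookup (antiDiagAux 0 xs) i ≡ indicator (head (drop (toℕ i) xs))
    row i = row-antiDiag 0 xs (toℕ i) i refl

    rowOne : RowOneBeyondRowZero (antiDiagAux 0 xs)
    rowOne r₀ r₁ k e₀ e₁ beyond =
      trans (cong (λ v → lookup v k) (row-antiDiag 0 xs 1 r₁ e₁))
            (second-beyond-first dec k (λ k′ k<k′ →
               trans (sym (cong (λ v → lookup v k′) (row-antiDiag 0 xs 0 r₀ e₀))) (beyond k′ k<k′)))

    tails : TailDominated (antiDiagAux 0 xs)
    tails i i′ e p = subst₂ _≤_ (cong (λ v → tailSum v p) (sym (row-antiDiag 0 xs (suc (toℕ i)) i′ e)))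
                                (cong (λ v → tailSum v (suc p)) (sym (row i)))
                                (consecutive-dominated dec (toℕ i) p)

module TableauRows {n : ℕ} where
  open StrongAD {n}

  reverseAcc-increasing : ∀ {x : Fin n} xs acc → Linked F._>_ (x ∷ xs) → Linked F._<_ (x ∷ acc) →
                          Linked F._<_ (L.reverseAcc (x ∷ acc) xs)
  reverseAcc-increasing [] acc _ inc = inc
  reverseAcc-increasing (y ∷ ys) acc (x>y ∷ dec) inc = reverseAcc-increasing ys _ dec (x>y ∷ inc)

  reverse-decreasing : ∀ {xs : List (Fin n)} → Linked F._>_ xs → Linked F._<_ (reverse xs)
  reverse-decreasing {[]} _ = []
  reverse-decreasing {x ∷ xs} dec = reverseAcc-increasing xs [] dec [-]

  row-initial : (O : MonomialOrder n) → IsAntiDiagonal O → ∀ {r} → Linked F._>_ r →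
                IsInitial O (Δ (reverse r)) (antiDiag (reverse r))
  row-initial O antiDiagonal {r} dec = antiDiagonal (reverse r) (reverse-decreasing dec)

  row-AD⁺ : ∀ {r : List (Fin n)} → Linked F._>_ r → AD⁺ (antiDiag (reverse r))
  row-AD⁺ {r} dec = subst (λ ys → AD⁺ (antiDiagAux 0 ys)) (sym (LP.reverse-involutive r)) (AD⁺-antiDiag dec)

open TermOrder using (initial-productP)
open StrongAD using (AD⁺⇒InAD; AD⁺-product)
open TableauRows using (row-initial; row-AD⁺)

proposition3p2 : (n : ℕ) (O : MonomialOrder n) → IsAntiDiagonal O →
                 (Y : Tableau n) → IsRSCT Y →
                 ∃ λ m → IsInitial O (ΔY Y) m × InAD m
proposition3p2 n O antiDiagonal Y rsct = ρY , ρY-initial , AD⁺⇒InAD ρY-AD⁺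
  where
  rowsDecreasing : All (Linked F._>_) Y
  rowsDecreasing = IsRSCT.rowStrict rsct

  rowMonomial : List (Fin n) → Mon n
  rowMonomial r = antiDiag (reverse r)

  ρY : Mon n
  ρY = foldr _⊗_ 𝟙 (map rowMonomial Y)

  ρY-initial : IsInitial O (ΔY Y) ρY
  ρY-initial = initial-productP O (λ r → Δ (reverse r)) rowMonomial Y
                 (All.map (row-initial O antiDiagonal) rowsDecreasing)

  ρY-AD⁺ : StrongAD.AD⁺ ρY
  ρY-AD⁺ = AD⁺-product (map rowMonomial Y) (AllP.map⁺ (All.map row-AD⁺ rowsDecreasing))
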